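{- Let $n\geq5$ and let $\overrightarrow{G}$ be a weakly connected spanning closed subgraph of $\overrightarrow{C_n^2}$. If $k$ and $p$ are integers with $0\leq p<n$ and $\{e_{k-1},f_k,f_{k+2},\dots,f_{k+2p-2},e_{k+2p}\}\subseteq E(\overrightarrow{G})$, then $\{e_k,e_{k+1},\dots,e_{k+2p-1}\}\subseteq E(\overrightarrow{G})$.
   Context: For $n\geq 5$, the directed square cycle $\overrightarrow{C_n^2}$ has vertex set $\mathbb{Z}_n$, writing $v_i=i+n\mathbb{Z}$ for $i\in\mathbb{Z}$ (indices modulo $n$), and edges $e_i=(v_i,v_{i+1})$ (frames) and $f_i=(v_i,v_{i+2})$ (windows), $i\in\mathbb{Z}$. A spanning subgraph has vertex set $\mathbb{Z}_n$ and a subset of the edges; it is weakly connected if its underlying undirected graph is connected. The triangle $T_i$ is the edge set $\{e_i,e_{i+1},f_i\}$. A subgraph $\overrightarrow{G}$ is closed if for every $i\in\mathbb{Z}$, either $|T_i\cap E(\overrightarrow{G})|\leq 1$ or $T_i\subseteq E(\overrightarrow{G})$. -}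

module Defs where

open import Data.Nat using (ℕ; NonZero; _≤_)
open import Data.Bool using (Bool; true; false)
open import Data.Fin using (Fin; fromℕ<)
open import Data.Integer using (ℤ; _+_; +_; _%ℕ_)
open import Data.Integer.DivMod using (n%ℕd<d)
open import Data.Product using (Σ; _×_)
open import Data.Sum using (_⊎_)
open import Relation.Binary.PropositionalEquality using (_≡_)
open import Relation.Binary.Construct.Closure.ReflexiveTransitive using (Star)

v : (n : ℕ) .{{_ : NonZero n}} → ℤ → Fin n
v n i = fromℕ< (n%ℕd<d i n)

-- A spanning subgraph of C_n^2: a choice of which frames e_j and which windows f_j
-- (j ∈ ℤ_n) belong to it.  For n ≥ 5 the 2n edges e_j, f_j are pairwise distinct.
record Subgraph (n : ℕ) : Set where
  field
    frame  : Fin n → Bool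
    window : Fin n → Bool
open Subgraph public

module _ {n : ℕ} .{{_ : NonZero n}} where

  eIn : Subgraph n → ℤ → Set
  eIn G i = frame G (v n i) ≡ true

  fIn : Subgraph n → ℤ → Set
  fIn G i = window G (v n i) ≡ true

  Adj : Subgraph n → Fin n → Fin n → Set
  Adj G x y = Σ ℤ λ i →
      (eIn G i × ((x ≡ v n i × y ≡ v n (i + + 1)) ⊎ (y ≡ v n i × x ≡ v n (i + + 1))))
    ⊎ (fIn G i × ((x ≡ v n i × y ≡ v n (i + + 2)) ⊎ (y ≡ v n i × x ≡ v n (i + + 2))))

  WeaklyConnected : Subgraph n → Set
  WeaklyConnected G = ∀ x y → Star (Adj G) x y

  b2ℕ : Bool → ℕ
  b2ℕ true = 1
  b2ℕ false = 0

  triCount : Subgraph n → ℤ → ℕ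
  triCount G i = b2ℕ (frame G (v n i)) Data.Nat.+ b2ℕ (frame G (v n (i + + 1)))
                 Data.Nat.+ b2ℕ (window G (v n i))

  Closed : Subgraph n → Set
  Closed G = ∀ (i : ℤ) → triCount G i ≤ 1 ⊎ (eIn G i × eIn G (i + + 1) × fIn G i)

-- Call the vertex v_{k+2t+1} (t < p) a gap if the frame e_{k+2t} is missing.  As the window
-- f_{k+2t} lies in the closed subgraph G, a gap meets no frame of G, so only windows leave it.
-- Closedness transports the missing frames along such a window, and the frames e_{k-1} and
-- e_{k+2p} at the two ends of the path forbid leaving the odd positions k+1, ..., k+2p-1: the
-- window leads to another gap.  So everything weakly connected to a gap is a gap, yet v_k,
-- meeting the frame e_{k-1}, is not.
module Submission where

open import Defs
open import Data.Bool using (Bool; true; false)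
open import Data.Empty using (⊥-elim)
open import Data.Fin using (Fin)
open import Data.Fin.Properties using (fromℕ<-cong; fromℕ<-injective)
open import Data.Integer using (ℤ; _+_; _-_; +_; ∣_∣; _%ℕ_; _/ℕ_)
open import Data.Integer as ℤ using ()
open import Data.Integer.DivMod using (n%ℕd<d; a≡a%ℕn+[a/ℕn]*n)
open import Data.Integer.Properties using (∣i*j∣≡∣i∣*∣j∣; ∣m⊝n∣≤m⊔n; m-n≡m⊖n; ∣i∣≡0⇒i≡0; i-j≡0⇒i≡j; pos-+; +-injective; +-assoc; +-identityʳ)
open import Data.Integer.Tactic.RingSolver using (solve-∀)
open import Data.Nat using (ℕ; NonZero; zero; suc; _≤_; _<_; _*_; _⊔_; s≤s)
import Data.Nat as ℕ using (_+_)
import Data.Nat.Properties as ℕ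
open import Data.Product using (Σ; Σ-syntax; _×_; _,_; proj₁; proj₂)
open import Data.Sum as Sum using (_⊎_; inj₁; inj₂)
open import Function using (_∘_; id)
open import Relation.Binary.Construct.Closure.ReflexiveTransitive using (Star; fold)
open import Relation.Binary.Core using (Rel)
open import Relation.Binary.PropositionalEquality
open import Relation.Unary using (Pred)
open import Relation.Nullary using (Dec; yes; no; ¬_)

module _ {n : ℕ} .{{_ : NonZero n}} where

  remainder-unique : ∀ {r s} (a b : ℤ) → r < n → s < n →
                     + r + a ℤ.* + n ≡ + s + b ℤ.* + n → r ≡ s
  remainder-unique {r} {s} a b r<n s<n eq =
    +-injective (i-j≡0⇒i≡j (+ r) (+ s) (∣i∣≡0⇒i≡0 ∣r-s∣≡0))
    where
    r-s≡[b-a]n : + r - + s ≡ (b - a) ℤ.* + n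
    r-s≡[b-a]n = begin
      + r - + s                             ≡⟨ shift-both (+ r) (+ s) (a ℤ.* + n) ⟨
      (+ r + a ℤ.* + n) - (+ s + a ℤ.* + n) ≡⟨ cong (_- (+ s + a ℤ.* + n)) eq ⟩
      (+ s + b ℤ.* + n) - (+ s + a ℤ.* + n) ≡⟨ difference-of-multiples (+ s) a b (+ n) ⟩
      (b - a) ℤ.* + n                       ∎
      where
      open ≡-Reasoning
      shift-both : ∀ x y c → (x + c) - (y + c) ≡ x - y
      shift-both = solve-∀
      difference-of-multiples : ∀ x a b m → (x + b ℤ.* m) - (x + a ℤ.* m) ≡ (b - a) ℤ.* m
      difference-of-multiples = solve-∀
    ∣r-s∣≡∣b-a∣n : ∣ + r - + s ∣ ≡ ∣ b - a ∣ * n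
    ∣r-s∣≡∣b-a∣n = trans (cong ∣_∣ r-s≡[b-a]n) (∣i*j∣≡∣i∣*∣j∣ (b - a) (+ n))
    ∣r-s∣<n : ∣ + r - + s ∣ < n
    ∣r-s∣<n = ℕ.≤-<-trans (subst (_≤ r ⊔ s) (cong ∣_∣ (sym (m-n≡m⊖n r s))) (∣m⊝n∣≤m⊔n r s))
                          (ℕ.⊔-lub r<n s<n)
    ∣b-a∣≡0 : ∣ b - a ∣ ≡ 0
    ∣b-a∣≡0 = ℕ.n<1⇒n≡0 (ℕ.*-cancelʳ-< n _ 1
                (subst₂ _<_ ∣r-s∣≡∣b-a∣n (sym (ℕ.*-identityˡ n)) ∣r-s∣<n))
    ∣r-s∣≡0 : ∣ + r - + s ∣ ≡ 0
    ∣r-s∣≡0 = trans ∣r-s∣≡∣b-a∣n (cong (_* n) ∣b-a∣≡0)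

  %ℕ-+-multiple : ∀ i q → (i + q ℤ.* + n) %ℕ n ≡ i %ℕ n
  %ℕ-+-multiple i q = remainder-unique ((i + q ℤ.* + n) /ℕ n) (i /ℕ n + q)
                        (n%ℕd<d (i + q ℤ.* + n) n) (n%ℕd<d i n) (begin
    + ((i + q ℤ.* + n) %ℕ n) + ((i + q ℤ.* + n) /ℕ n) ℤ.* + n ≡⟨ a≡a%ℕn+[a/ℕn]*n (i + q ℤ.* + n) n ⟨
    i + q ℤ.* + n                                          ≡⟨ cong (_+ q ℤ.* + n) (a≡a%ℕn+[a/ℕn]*n i n) ⟩
    (+ (i %ℕ n) + (i /ℕ n) ℤ.* + n) + q ℤ.* + n             ≡⟨ collect (+ (i %ℕ n)) (i /ℕ n) q (+ n) ⟩
    + (i %ℕ n) + (i /ℕ n + q) ℤ.* + n                      ∎)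
    where
    open ≡-Reasoning
    collect : ∀ r a q m → (r + a ℤ.* m) + q ℤ.* m ≡ r + (a + q) ℤ.* m
    collect = solve-∀

  %ℕ-+-cong : ∀ {i j} c → i %ℕ n ≡ j %ℕ n → (i + c) %ℕ n ≡ (j + c) %ℕ n
  %ℕ-+-cong {i} {j} c i%n≡j%n = begin
    (i + c) %ℕ n                                   ≡⟨ cong (_%ℕ n) i+c≡j+c+qn ⟩
    ((j + c) + (i /ℕ n - j /ℕ n) ℤ.* + n) %ℕ n    ≡⟨ %ℕ-+-multiple (j + c) (i /ℕ n - j /ℕ n) ⟩
    (j + c) %ℕ n                                   ∎
    where
    open ≡-Reasoning
    regroup : ∀ r a b m c → (r + a ℤ.* m) + c ≡ ((r + b ℤ.* m) + c) + (a - b) ℤ.* m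
    regroup = solve-∀
    i+c≡j+c+qn : i + c ≡ (j + c) + (i /ℕ n - j /ℕ n) ℤ.* + n
    i+c≡j+c+qn = begin
      i + c
        ≡⟨ cong (_+ c) (a≡a%ℕn+[a/ℕn]*n i n) ⟩
      (+ (i %ℕ n) + (i /ℕ n) ℤ.* + n) + c
        ≡⟨ cong (λ r → (+ r + (i /ℕ n) ℤ.* + n) + c) i%n≡j%n ⟩
      (+ (j %ℕ n) + (i /ℕ n) ℤ.* + n) + c
        ≡⟨ regroup (+ (j %ℕ n)) (i /ℕ n) (j /ℕ n) (+ n) c ⟩
      ((+ (j %ℕ n) + (j /ℕ n) ℤ.* + n) + c) + (i /ℕ n - j /ℕ n) ℤ.* + n
        ≡⟨ cong (λ z → (z + c) + (i /ℕ n - j /ℕ n) ℤ.* + n) (a≡a%ℕn+[a/ℕn]*n j n) ⟨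
      (j + c) + (i /ℕ n - j /ℕ n) ℤ.* + n
        ∎

  v-+-cong : ∀ i j c → v n i ≡ v n j → v n (i + c) ≡ v n (j + c)
  v-+-cong i j c vi≡vj = fromℕ<-cong _ _
    (%ℕ-+-cong {i} {j} c (fromℕ<-injective _ _ (n%ℕd<d i n) (n%ℕd<d j n) vi≡vj)) _ _

  v-+-cancel : ∀ i j c → v n (i + c) ≡ v n (j + c) → v n i ≡ v n j
  v-+-cancel i j c v[i+c]≡v[j+c] =
    subst₂ (λ a b → v n a ≡ v n b) (+-cancel i c) (+-cancel j c)
      (v-+-cong (i + c) (j + c) (ℤ.- c) v[i+c]≡v[j+c])
    where
    +-cancel : ∀ i c → (i + c) + ℤ.- c ≡ i
    +-cancel = solve-∀

  window-frames-agree : (G : Subgraph n) → Closed G → ∀ i → fIn G i →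
                        frame G (v n i) ≡ frame G (v n (i + + 1))
  window-frames-agree G closed i f∈G = agree f∈G (closed i)
    where
    agree : ∀ {a b w} → w ≡ true →
            b2ℕ {n} a ℕ.+ b2ℕ {n} b ℕ.+ b2ℕ {n} w ≤ 1 ⊎ (a ≡ true × b ≡ true × w ≡ true) → a ≡ b
    agree {false} {false} _    _                   = refl
    agree {true}  {true}  _    _                   = refl
    agree {false} {true}  refl (inj₁ (s≤s ()))
    agree {false} {true}  refl (inj₂ (() , _))
    agree {true}  {false} refl (inj₁ (s≤s ()))
    agree {true}  {false} refl (inj₂ (_ , () , _))

preserved-by-Star : ∀ {a ℓ p} {A : Set a} {R : Rel A ℓ} (P : Pred A p) →
                    (∀ {x y} → R x y → P x → P y) → ∀ {x y} → Star R x y → P x → P y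
preserved-by-Star P step = fold (λ x y → P x → P y) (λ r Px→Py → Px→Py ∘ step r) id

+-suc-offset : ∀ k m → k + + suc m ≡ (k + + m) + + 1
+-suc-offset k m = trans (cong (λ z → k + z) (pos-+ 1 m)) (shuffle k (+ m))
  where
  shuffle : ∀ a b → a + (+ 1 + b) ≡ (a + b) + + 1
  shuffle = solve-∀

even-or-odd : ∀ i → Σ[ t ∈ ℕ ] (i ≡ 2 * t ⊎ i ≡ suc (2 * t))
even-or-odd zero = 0 , inj₁ refl
even-or-odd (suc i) with even-or-odd i
... | t , inj₁ i≡2t   = t , inj₂ (cong suc i≡2t)
... | t , inj₂ i≡2t+1 = suc t , inj₁ (trans (cong suc i≡2t+1) (sym (ℕ.*-suc 2 t)))

module FramePath {n : ℕ} .{{_ : NonZero n}} (G : Subgraph n) (closed : Closed G) (k : ℤ) (p : ℕ)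
  (e-before : eIn G (k - + 1))
  (windows : ∀ j → j < p → fIn G (k + + (2 * j)))
  (e-after : eIn G (k + + (2 * p))) where

  fr : ℤ → Bool
  fr i = frame G (v n i)

  even odd : ℕ → ℤ
  even t = k + + (2 * t)
  odd t = even t + + 1

  odd-+1 : ∀ t → odd t + + 1 ≡ even (suc t)
  odd-+1 t = begin
    (k + + (2 * t) + + 1) + + 1  ≡⟨ cong (_+ + 1) (+-suc-offset k (2 * t)) ⟨
    k + + suc (2 * t) + + 1      ≡⟨ +-suc-offset k (suc (2 * t)) ⟨
    k + + (2 ℕ.+ 2 * t)         ≡⟨ cong (λ m → k + + m) (ℕ.*-suc 2 t) ⟨
    k + + (2 * suc t)           ∎
    where open ≡-Reasoning

  before : ℕ → ℤ
  before zero    = k - + 1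
  before (suc t) = odd t

  before-+1 : ∀ t → before t + + 1 ≡ even t
  before-+1 zero    = [k-1]+1≡k+0 k
    where
    [k-1]+1≡k+0 : ∀ k → (k - + 1) + + 1 ≡ k + + 0
    [k-1]+1≡k+0 = solve-∀
  before-+1 (suc t) = odd-+1 t

  before-+2 : ∀ t → before t + + 2 ≡ odd t
  before-+2 t = trans (sym (+-assoc (before t) (+ 1) (+ 1))) (cong (_+ + 1) (before-+1 t))

  even≡odd : ∀ t → t < p → fr (even t) ≡ fr (odd t)
  even≡odd t t<p = window-frames-agree G closed (even t) (windows t t<p)

  true≢false : true ≢ false
  true≢false ()

  Gap : Fin n → Set
  Gap x = Σ[ t ∈ ℕ ] t < p × fr (even t) ≡ false × x ≡ v n (odd t)

  gap-frame-free : ∀ {x i} → Gap x → x ≡ v n i ⊎ x ≡ v n (i + + 1) → fr i ≡ false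
  gap-frame-free (t , t<p , gap , x≡odd) (inj₁ x≡vi) =
    trans (cong (frame G) (trans (sym x≡vi) x≡odd)) (trans (sym (even≡odd t t<p)) gap)
  gap-frame-free {i = i} (t , t<p , gap , x≡odd) (inj₂ x≡vi+1) =
    trans (cong (frame G) (v-+-cancel i (even t) (+ 1) (trans (sym x≡vi+1) x≡odd))) gap

  window-at : ∀ i j → v n i ≡ v n j → fIn G i → fIn G j
  window-at i j vi≡vj = subst (λ y → window G y ≡ true) vi≡vj

  frame-after-gap : ∀ t i → t < p → fr (even t) ≡ false → v n i ≡ v n (odd t) → fIn G i →
                    fr (even (suc t)) ≡ false
  frame-after-gap t i t<p gap vi≡odd f∈G = begin
    fr (even (suc t)) ≡⟨ cong fr (odd-+1 t) ⟨
    fr (odd t + + 1)  ≡⟨ window-frames-agree G closed (odd t) (window-at i (odd t) vi≡odd f∈G) ⟨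
    fr (odd t)        ≡⟨ even≡odd t t<p ⟨
    fr (even t)       ≡⟨ gap ⟩
    false             ∎
    where open ≡-Reasoning

  frame-before-gap : ∀ t i → fr (even t) ≡ false → v n i ≡ v n (before t) → fIn G i →
                     fr (before t) ≡ false
  frame-before-gap t i gap vi≡before f∈G = begin
    fr (before t)         ≡⟨ window-frames-agree G closed (before t) (window-at i (before t) vi≡before f∈G) ⟩
    fr (before t + + 1)   ≡⟨ cong fr (before-+1 t) ⟩
    fr (even t)           ≡⟨ gap ⟩
    false                 ∎
    where open ≡-Reasoning

  gap-forward : ∀ {x i} → Gap x → x ≡ v n i → fIn G i → Gap (v n (i + + 2))
  gap-forward {i = i} (t , t<p , gap , x≡odd) x≡vi f∈G = advance (suc t ℕ.<? p)
    where
    vi≡odd : v n i ≡ v n (odd t)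
    vi≡odd = trans (sym x≡vi) x≡odd
    next-gap : fr (even (suc t)) ≡ false
    next-gap = frame-after-gap t i t<p gap vi≡odd f∈G
    advance : Dec (suc t < p) → Gap (v n (i + + 2))
    advance (yes t+1<p) =
      suc t , t+1<p , next-gap , trans (v-+-cong i (odd t) (+ 2) vi≡odd) (cong (v n) (before-+2 (suc t)))
    advance (no t+1≮p) =
      ⊥-elim (true≢false (trans (sym e-after) (subst (λ m → fr (even m) ≡ false) t+1≡p next-gap)))
      where
      t+1≡p : suc t ≡ p
      t+1≡p = ℕ.≤-antisym t<p (ℕ.≮⇒≥ t+1≮p)

  gap-backward : ∀ {x i} → Gap x → x ≡ v n (i + + 2) → fIn G i → Gap (v n i)
  gap-backward {i = i} (t , t<p , gap , x≡odd) x≡vi+2 f∈G = retreat t refl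
    where
    vi≡before : v n i ≡ v n (before t)
    vi≡before = v-+-cancel i (before t) (+ 2)
                  (trans (sym x≡vi+2) (trans x≡odd (cong (v n) (sym (before-+2 t)))))
    previous-gap : fr (before t) ≡ false
    previous-gap = frame-before-gap t i gap vi≡before f∈G
    retreat : ∀ s → s ≡ t → Gap (v n i)
    retreat zero    refl = ⊥-elim (true≢false (trans (sym e-before) previous-gap))
    retreat (suc s) refl = s , s<p , trans (even≡odd s s<p) previous-gap , vi≡before
      where
      s<p : s < p
      s<p = ℕ.<-trans (ℕ.n<1+n s) t<p

  gap-step : ∀ {x y} → Adj G x y → Gap x → Gap y
  gap-step (i , inj₁ (e∈G , ends)) gap =
    ⊥-elim (true≢false (trans (sym e∈G) (gap-frame-free {i = i} gap (Sum.map proj₁ proj₂ ends))))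
  gap-step (i , inj₂ (f∈G , inj₁ (x≡vi , y≡vi+2))) gap =
    subst Gap (sym y≡vi+2) (gap-forward {i = i} gap x≡vi f∈G)
  gap-step (i , inj₂ (f∈G , inj₂ (y≡vi , x≡vi+2))) gap =
    subst Gap (sym y≡vi) (gap-backward {i = i} gap x≡vi+2 f∈G)

  no-gap : WeaklyConnected G → ∀ {x} → ¬ Gap x
  no-gap connected {x} gap =
    true≢false (trans (sym e-before) (gap-frame-free {i = k - + 1} gap-at-k (inj₂ vk≡v[k-1+1])))
    where
    gap-at-k : Gap (v n k)
    gap-at-k = preserved-by-Star Gap gap-step (connected x (v n k)) gap
    vk≡v[k-1+1] : v n k ≡ v n ((k - + 1) + + 1)
    vk≡v[k-1+1] = cong (v n) (sym (trans (before-+1 0) (+-identityʳ k)))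

  missing-frame⇒gap : ∀ i → i < 2 * p → fr (k + + i) ≡ false → Σ (Fin n) Gap
  missing-frame⇒gap i i<2p missing with even-or-odd i
  ... | t , inj₁ refl = v n (odd t) , t , ℕ.*-cancelˡ-< 2 t p i<2p , missing , refl
  ... | t , inj₂ refl = v n (odd t) , t , t<p , trans (even≡odd t t<p) odd-missing , refl
    where
    t<p : t < p
    t<p = ℕ.*-cancelˡ-< 2 t p (ℕ.<-trans (ℕ.n<1+n (2 * t)) i<2p)
    odd-missing : fr (odd t) ≡ false
    odd-missing = trans (cong fr (sym (+-suc-offset k (2 * t)))) missing

  frames-present : WeaklyConnected G → ∀ i → i < 2 * p → eIn G (k + + i)
  frames-present connected i i<2p with fr (k + + i) in missing
  ... | true  = refl
  ... | false = ⊥-elim (no-gap connected (proj₂ (missing-frame⇒gap i i<2p missing)))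

lemma3p1 : (n : ℕ) .{{_ : NonZero n}} → 5 ≤ n → (G : Subgraph n) →
    WeaklyConnected G → Closed G →
    (k : ℤ) (p : ℕ) → p < n →
    eIn G (k - + 1) → (∀ (j : ℕ) → j < p → fIn G (k + + (2 * j))) → eIn G (k + + (2 * p)) →
    ∀ (i : ℕ) → i < 2 * p → eIn G (k + + i)
lemma3p1 n _ G connected closed k p _ e-before windows e-after =
  FramePath.frames-present G closed k p e-before windows e-after connected
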